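{- Let $n\ge3$, $m\ge1$, and let $T_R=(e_{ij})_{1\le i\le j\le n-1}$ be the Shi tableau of a dominant region $R$ of the $m$-Shi arrangement in $V_n$. Then the array $(e_{ij})_{1\le i\le j\le n-2}$ (i.e. $T_R$ with the entries $e_{i,n-1}$ removed) is the Shi tableau of some dominant region $\tilde R$ of the $m$-Shi arrangement in $V_{n-1}$.
   Context: For $N\ge2$: let $e_1,\dots,e_N$ be the standard basis of $\mathbb R^N$ with standard inner product $\langle\cdot,\cdot\rangle$, $V_N=\{a\in\mathbb R^N:\sum a_i=0\}$, $\alpha_{ij}=e_i-e_{j+1}$ ($1\le i\le j\le N-1$), $\alpha_i=\alpha_{ii}$, $\theta=\alpha_{1,N-1}$, $H_{\alpha,k}=\{v\in V_N:\langle v,\alpha\rangle=k\}$. The $m$-Shi arrangement in $V_N$ is $\{H_{\alpha_{ij},k}:1\le i\le j\le N-1,\ -m<k\le m\}$; regions are connected components of the complement of the union of its hyperplanes; a region is dominant if contained in $\{v:\langle v,\alpha_i\rangle\ge0\ \forall i\}$. Alcoves are components of the complement of all $H_{\alpha_{ij},k}$, $k\in\mathbb Z$; the fundamental alcove $A_0$ is the interior of $\{v:\langle v,\theta\rangle\le1,\langle v,\alpha_i\rangle\ge0\ \forall i\}$. Each region contains a unique alcove separated from $A_0$ by the fewest hyperplanes $H_{\alpha,k}$ ($k\in\mathbb Z$), its $m$-minimal alcove. The Shi coordinates of an alcove $\mathcal A$ are the integers $k_{ij}$ with $k_{ij}<\langle x,\alpha_{ij}\rangle<k_{ij}+1$ for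 $x\in\mathcal A$. The Shi tableau of a region $R$ is $T_R=(e_{ij})_{1\le i\le j\le N-1}$ with $e_{ij}=\min(k_{ij},m)$, where $k_{ij}$ are the Shi coordinates of the $m$-minimal alcove of $R$.
   Formalization: Points of $V_n$ and $V_{n-1}$ have rational coordinates, so the regions $R$ and $\tilde R$ and all alcoves are given by rational points they contain. -}

module Defs where

open import Data.Nat as ℕ using (ℕ; zero; suc)
open import Data.Integer as ℤ using (ℤ; +_; ∣_∣)
open import Data.Rational as ℚ using (ℚ; 0ℚ; _/_)
open import Data.Fin as Fin using (Fin; inject₁)
open import Data.List using (List; map; foldr)
open import Data.List as L using ()
open import Data.Fin.Base using ()
open import Data.List.Base using ()
open import Data.Product using (Σ; _×_; ∃)
open import Relation.Binary.PropositionalEquality using (_≡_)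
open import Relation.Nullary using (¬_; yes; no)
open import Data.Fin using (_≤_)
open import Data.List.Base using (allFin)
open import Data.Nat.ListAction using () renaming (sum to sumℕ)

-- Points of ℝ^N are represented by rational points ℚ^N.
-- The ambient dimension is N = suc n; the simple roots / positive roots are
-- indexed by i ≤ j in Fin n (0-indexed version of 1 ≤ i ≤ j ≤ N-1).
Pt : ℕ → Set
Pt N = Fin N → ℚ

sumℚ : ∀ {N} → Pt N → ℚ
sumℚ {N} x = foldr ℚ._+_ 0ℚ (map x (allFin N))

InV : ∀ {N} → Pt N → Set
InV x = sumℚ x ≡ 0ℚ

-- ⟨x , α_ij⟩ = x_i - x_{j+1}   (0-indexed: x (inject₁ i) - x (suc j))
ip : ∀ {n} → Pt (suc n) → Fin n → Fin n → ℚ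
ip x i j = x (inject₁ i) ℚ.- x (Fin.suc j)

ℤtoℚ : ℤ → ℚ
ℤtoℚ k = k / 1

InShiRange : ℕ → ℤ → Set
InShiRange m k = (ℤ.- (+ m) ℤ.< k) × (k ℤ.≤ + m)

InShiComplement : ∀ {n} → ℕ → Pt (suc n) → Set
InShiComplement {n} m x =
  (i j : Fin n) → i ≤ j → (k : ℤ) → InShiRange m k → ¬ (ip x i j ≡ ℤtoℚ k)

SameRegion : ∀ {n} → ℕ → Pt (suc n) → Pt (suc n) → Set
SameRegion {n} m x y =
  (i j : Fin n) → i ≤ j → (k : ℤ) → InShiRange m k →
  (ip x i j ℚ.< ℤtoℚ k → ip y i j ℚ.< ℤtoℚ k) × (ip y i j ℚ.< ℤtoℚ k → ip x i j ℚ.< ℤtoℚ k)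

Dominant : ∀ {n} → Pt (suc n) → Set
Dominant {n} x = (i : Fin n) → 0ℚ ℚ.≤ ip x i i

InAlcove : ∀ {n} → Pt (suc n) → (Fin n → Fin n → ℤ) → Set
InAlcove {n} y c =
  (i j : Fin n) → i ≤ j → (ℤtoℚ (c i j) ℚ.< ip y i j) × (ip y i j ℚ.< ℤtoℚ (c i j ℤ.+ + 1))

-- number of hyperplanes H_{α,k} (k ∈ ℤ) separating the alcove with Shi
-- coordinates c from A₀ (whose Shi coordinates are all 0): Σ_{i≤j} |c_ij|
sepCount : ∀ {n} → (Fin n → Fin n → ℤ) → ℕ
sepCount {n} c = sumℕ (map (λ i → sumℕ (map (λ j → term i j) (allFin n))) (allFin n))
  where
  term : Fin n → Fin n → ℕ
  term i j with i Fin.≤? j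
  ... | yes _ = ∣ c i j ∣
  ... | no _ = 0

-- T is the Shi tableau of the m-Shi region containing x:
-- there is an alcove (Shi coordinates c, witnessed by a point y) inside the
-- region of x which is separated from A₀ by the fewest hyperplanes among all
-- alcoves in that region (the m-minimal alcove), and T_ij = min(c_ij, m).
IsShiTableau : ∀ {n} → ℕ → Pt (suc n) → (Fin n → Fin n → ℤ) → Set
IsShiTableau {n} m x T =
  Σ (Fin n → Fin n → ℤ) λ c → Σ (Pt (suc n)) λ y →
    InV y × InAlcove y c × SameRegion m x y ×
    ((c' : Fin n → Fin n → ℤ) (y' : Pt (suc n)) →
       InV y' → InAlcove y' c' → SameRegion m x y' → sepCount c ℕ.≤ sepCount c') ×
    ((i j : Fin n) → i ≤ j → T i j ≡ c i j ℤ.⊓ + m)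

{-# OPTIONS --safe #-}
-- In a dominant region R of the m-Shi arrangement all Shi coordinates k_ij of alcoves are
-- nonnegative, and two alcoves lie in the same region exactly when their coordinates agree after
-- truncation at m. Starting from any alcove of R, put G_ab = k_ab if k_ab < m and otherwise
-- G_ab = max(m, max_l G_al + G_(l+1)b). By induction on b - a, G satisfies Shi's inequalities
-- G_al + G_(l+1)b ≤ G_ab ≤ G_al + G_(l+1)b + 1, so it is the coordinate array of an alcove; this
-- alcove lies in R, and since each entry is at most m or a sum of two smaller ones, it lies below
-- every alcove of R entrywise, so it is the m-minimal alcove. G_ab only involves indices in
-- [a, b], so G without its last column is the same construction for the dominant region obtained
-- by forgetting the last coordinate, and its truncation at m is T_R without its last column.

module Submission where

open import Defs
open import Data.Nat as ℕ using (ℕ; zero; suc; s≤s)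
import Data.Nat.Properties as ℕP
open import Data.Integer as ℤ using (ℤ; +_)
import Data.Integer.Properties as ℤP
open import Data.Rational as ℚ using (ℚ; 0ℚ)
import Data.Rational.Properties as ℚP
open import Data.Rational.Unnormalised as ℚᵘ using (mkℚᵘ; *≡*; *<*; *≤*)
import Data.Rational.Unnormalised.Properties as ℚᵘP
open import Data.Fin as Fin using (Fin; inject₁; toℕ; fromℕ<)
import Data.Fin.Properties as FinP
open import Data.List using (List; []; _∷_; map; foldr; allFin; length)
import Data.List.Properties as ListP
open import Data.Nat.ListAction using () renaming (sum to sumℕ)
open import Data.Product using (Σ; _×_; _,_; proj₁; proj₂)
open import Data.Sum as Sum using (_⊎_; inj₁; inj₂)
open import Data.Empty using (⊥-elim)
open import Function using (_∘_)
open import Relation.Nullary using (¬_; yes; no; Dec)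
open import Relation.Nullary.Decidable using (_×-dec_; _⊎-dec_)
open import Relation.Binary.Definitions using (tri<; tri≈; tri>)
open import Relation.Unary using (Decidable)
open import Relation.Binary.PropositionalEquality
open import Data.Integer.Tactic.RingSolver using (solve-∀)
import Data.Nat.Tactic.RingSolver as ℕSolver
import Relation.Binary.Reasoning.Setoid as SetoidReasoning
open import Data.Rational.Solver using (module +-*-Solver)

_/1+_ : ℤ → ℕ → ℚ
u /1+ d = ℚ.fromℚᵘ (mkℚᵘ u d)

toℚᵘ-/1+ : ∀ u d → ℚ.toℚᵘ (u /1+ d) ℚᵘ.≃ mkℚᵘ u d
toℚᵘ-/1+ u d = ℚP.toℚᵘ-fromℚᵘ (mkℚᵘ u d)

/1+-+ : ∀ u v d → u /1+ d ℚ.+ v /1+ d ≡ (u ℤ.+ v) /1+ d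
/1+-+ u v d = ℚP.toℚᵘ-injective (begin
    ℚ.toℚᵘ (u /1+ d ℚ.+ v /1+ d)              ≈⟨ ℚP.toℚᵘ-homo-+ (u /1+ d) (v /1+ d) ⟩
    ℚ.toℚᵘ (u /1+ d) ℚᵘ.+ ℚ.toℚᵘ (v /1+ d)    ≈⟨ ℚᵘP.+-cong (toℚᵘ-/1+ u d) (toℚᵘ-/1+ v d) ⟩
    mkℚᵘ u d ℚᵘ.+ mkℚᵘ v d                    ≈⟨ *≡* (common-denominator u v (+ suc d)) ⟩
    mkℚᵘ (u ℤ.+ v) d                          ≈⟨ toℚᵘ-/1+ (u ℤ.+ v) d ⟨
    ℚ.toℚᵘ ((u ℤ.+ v) /1+ d)                  ∎)
  where
  open SetoidReasoning ℚᵘP.≃-setoid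
  common-denominator : ∀ u v e → (u ℤ.* e ℤ.+ v ℤ.* e) ℤ.* e ≡ (u ℤ.+ v) ℤ.* (e ℤ.* e)
  common-denominator = solve-∀

/1+-neg : ∀ u d → ℚ.- (u /1+ d) ≡ (ℤ.- u) /1+ d
/1+-neg u d = ℚP.toℚᵘ-injective (ℚᵘP.≃-trans (ℚP.toℚᵘ-homo‿- (u /1+ d))
  (ℚᵘP.≃-trans (ℚᵘP.-‿cong (toℚᵘ-/1+ u d)) (ℚᵘP.≃-sym (toℚᵘ-/1+ (ℤ.- u) d))))

/1+-expand : ∀ u d → u /1+ 0 ≡ (u ℤ.* + suc d) /1+ d
/1+-expand u d = ℚP.fromℚᵘ-cong {mkℚᵘ u 0} {mkℚᵘ (u ℤ.* + suc d) d} (*≡* (times-one u (+ suc d)))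
  where
  times-one : ∀ u e → u ℤ.* e ≡ (u ℤ.* e) ℤ.* ℤ.1ℤ
  times-one = solve-∀

/1+-mono-< : ∀ {u v} d → u ℤ.< v → u /1+ d ℚ.< v /1+ d
/1+-mono-< {u} {v} d u<v = ℚP.toℚᵘ-cancel-<
  (ℚᵘP.<-respˡ-≃ (ℚᵘP.≃-sym (toℚᵘ-/1+ u d)) (ℚᵘP.<-respʳ-≃ (ℚᵘP.≃-sym (toℚᵘ-/1+ v d))
    (*<* (ℤP.*-monoʳ-<-pos (+ suc d) u<v))))

ℤtoℚ-+ : ∀ a b → ℤtoℚ (a ℤ.+ b) ≡ ℤtoℚ a ℚ.+ ℤtoℚ b
ℤtoℚ-+ a b = sym (/1+-+ a b 0)

ℤtoℚ-cancel-< : ∀ {a b} → ℤtoℚ a ℚ.< ℤtoℚ b → a ℤ.< b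
ℤtoℚ-cancel-< {a} {b} q
  with ℚᵘP.<-respˡ-≃ (toℚᵘ-/1+ a 0) (ℚᵘP.<-respʳ-≃ (toℚᵘ-/1+ b 0) (ℚP.toℚᵘ-mono-< q))
... | *<* p = ℤP.*-cancelʳ-<-nonNeg (+ 1) p

ℤtoℚ-mono-≤ : ∀ {a b} → a ℤ.≤ b → ℤtoℚ a ℚ.≤ ℤtoℚ b
ℤtoℚ-mono-≤ {a} {b} a≤b = ℚP.toℚᵘ-cancel-≤
  (ℚᵘP.≤-respˡ-≃ (ℚᵘP.≃-sym (toℚᵘ-/1+ a 0)) (ℚᵘP.≤-respʳ-≃ (ℚᵘP.≃-sym (toℚᵘ-/1+ b 0))
    (*≤* (ℤP.*-monoʳ-≤-nonNeg (+ 1) a≤b))))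

<+1⇒≤ : ∀ {a b} → a ℤ.< b ℤ.+ + 1 → a ℤ.≤ b
<+1⇒≤ {a} {b} p = subst (a ℤ.≤_) (pred-of-succ b) (ℤP.i<j⇒i≤pred[j] p)
  where
  pred-of-succ : ∀ b → ℤ.-1ℤ ℤ.+ (b ℤ.+ + 1) ≡ b
  pred-of-succ = solve-∀

<⇒+1≤ : ∀ {a b} → a ℤ.< b → a ℤ.+ + 1 ℤ.≤ b
<⇒+1≤ {a} {b} p = subst (ℤ._≤ b) (ℤP.+-comm (+ 1) a) (ℤP.i<j⇒suc[i]≤j p)

≤⇒<+1 : ∀ {a b} → a ℤ.≤ b → a ℤ.< b ℤ.+ + 1
≤⇒<+1 {a} {b} p = ℤP.≤-<-trans p
  (subst (ℤ._< b ℤ.+ + 1) (ℤP.+-identityʳ b) (ℤP.+-monoʳ-< b (ℤ.+<+ (s≤s ℕ.z≤n))))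

-- Hyperplanes and regions

SameSide : ℕ → ℤ → ℤ → Set
SameSide m a b = ∀ k → InShiRange m k → (a ℤ.< k → b ℤ.< k) × (b ℤ.< k → a ℤ.< k)

floor-<-iff : ∀ {c s} k → ℤtoℚ c ℚ.< s → s ℚ.< ℤtoℚ (c ℤ.+ + 1) →
              (s ℚ.< ℤtoℚ k → c ℤ.< k) × (c ℤ.< k → s ℚ.< ℤtoℚ k)
floor-<-iff {c} k c<s s<c+1 =
  (λ s<k → ℤtoℚ-cancel-< (ℚP.<-trans c<s s<k)) ,
  (λ c<k → ℚP.<-≤-trans s<c+1 (ℤtoℚ-mono-≤ (<⇒+1≤ c<k)))

sameRegion⇒sameSide : ∀ {n m} {y y′ : Pt (suc n)} {c c′} → InAlcove y c → InAlcove y′ c′ →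
  SameRegion m y y′ → ∀ i j → i Fin.≤ j → SameSide m (c i j) (c′ i j)
sameRegion⇒sameSide yc y′c′ y~y′ i j i≤j k k∈R =
  (λ c<k → proj₁ (y′-side k) (proj₁ (y~y′ i j i≤j k k∈R) (proj₂ (y-side k) c<k))) ,
  (λ c′<k → proj₁ (y-side k) (proj₂ (y~y′ i j i≤j k k∈R) (proj₂ (y′-side k) c′<k)))
  where
  y-side = λ k → floor-<-iff k (proj₁ (yc i j i≤j)) (proj₂ (yc i j i≤j))
  y′-side = λ k → floor-<-iff k (proj₁ (y′c′ i j i≤j)) (proj₂ (y′c′ i j i≤j))

sameSide⇒sameRegion : ∀ {n m} {y y′ : Pt (suc n)} {c c′} → InAlcove y c → InAlcove y′ c′ →
  (∀ i j → i Fin.≤ j → SameSide m (c i j) (c′ i j)) → SameRegion m y y′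
sameSide⇒sameRegion yc y′c′ sides i j i≤j k k∈R =
  (λ y<k → proj₂ (y′-side k) (proj₁ (sides i j i≤j k k∈R) (proj₁ (y-side k) y<k))) ,
  (λ y′<k → proj₂ (y-side k) (proj₂ (sides i j i≤j k k∈R) (proj₁ (y′-side k) y′<k)))
  where
  y-side = λ k → floor-<-iff k (proj₁ (yc i j i≤j)) (proj₂ (yc i j i≤j))
  y′-side = λ k → floor-<-iff k (proj₁ (y′c′ i j i≤j)) (proj₂ (y′c′ i j i≤j))

sameRegion-sym : ∀ {n m} {x y : Pt (suc n)} → SameRegion m x y → SameRegion m y x
sameRegion-sym x~y i j i≤j k k∈R = proj₂ (x~y i j i≤j k k∈R) , proj₁ (x~y i j i≤j k k∈R)

sameRegion-trans : ∀ {n m} {x y z : Pt (suc n)} → SameRegion m x y → SameRegion m y z → SameRegion m x z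
sameRegion-trans x~y y~z i j i≤j k k∈R =
  (λ p → proj₁ (y~z i j i≤j k k∈R) (proj₁ (x~y i j i≤j k k∈R) p)) ,
  (λ p → proj₂ (x~y i j i≤j k k∈R) (proj₂ (y~z i j i≤j k k∈R) p))

<-iff-⊓< : ∀ {m k} a → k ℤ.≤ + m → (a ℤ.< k → a ℤ.⊓ + m ℤ.< k) × (a ℤ.⊓ + m ℤ.< k → a ℤ.< k)
<-iff-⊓< {m} {k} a k≤m = (ℤP.≤-<-trans (ℤP.i⊓j≤i a (+ m))) , backward
  where
  backward : a ℤ.⊓ + m ℤ.< k → a ℤ.< k
  backward a⊓m<k with ℤP.≤-total a (+ m)
  ... | inj₁ a≤m = subst (ℤ._< _) (ℤP.i≤j⇒i⊓j≡i a≤m) a⊓m<k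
  ... | inj₂ m≤a = ⊥-elim (ℤP.<-irrefl refl
        (ℤP.<-≤-trans (subst (ℤ._< _) (ℤP.i≥j⇒i⊓j≡j m≤a) a⊓m<k) k≤m))

⊓-sameSide : ∀ {m a b} → a ℤ.⊓ + m ≡ b ℤ.⊓ + m → SameSide m a b
⊓-sameSide {m} {a} {b} eq k (_ , k≤m) =
  (λ a<k → proj₂ (b-side) (subst (ℤ._< k) eq (proj₁ a-side a<k))) ,
  (λ b<k → proj₂ (a-side) (subst (ℤ._< k) (sym eq) (proj₁ b-side b<k)))
  where
  a-side = <-iff-⊓< a k≤m
  b-side = <-iff-⊓< b k≤m

-m<nonneg : ∀ {m k} → 1 ℕ.≤ m → + 0 ℤ.≤ k → ℤ.- (+ m) ℤ.< k
-m<nonneg {suc m} _ 0≤k = ℤP.<-≤-trans ℤ.-<+ 0≤k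

sameSide-⊓ : ∀ {m a b} → 1 ℕ.≤ m → + 0 ℤ.≤ a → SameSide m a b → a ℤ.⊓ + m ≡ b ℤ.⊓ + m
sameSide-⊓ {m} {a} {b} 1≤m 0≤a sides with a ℤ.<? + m
... | yes a<m = cong (ℤ._⊓ + m) (ℤP.≤-antisym a≤b b≤a)
  where
  b≤a : b ℤ.≤ a
  b≤a = <+1⇒≤ (proj₁ (sides (a ℤ.+ + 1) (-m<nonneg 1≤m (ℤP.≤-trans 0≤a (ℤP.<⇒≤ (≤⇒<+1 ℤP.≤-refl))) , <⇒+1≤ a<m))
                     (≤⇒<+1 ℤP.≤-refl))
  a≤b : a ℤ.≤ b
  a≤b = ℤP.≮⇒≥ (λ b<a → ℤP.<-irrefl refl (proj₂ (sides a (-m<nonneg 1≤m 0≤a , ℤP.<⇒≤ a<m)) b<a))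
... | no a≮m = trans (ℤP.i≥j⇒i⊓j≡j m≤a) (sym (ℤP.i≥j⇒i⊓j≡j m≤b))
  where
  m≤a = ℤP.≮⇒≥ a≮m
  m≤b = ℤP.≮⇒≥ (λ b<m → a≮m (proj₂ (sides (+ m) (-m<nonneg 1≤m (ℤ.+≤+ ℕ.z≤n) , ℤP.≤-refl)) b<m))

Succ : ∀ {n} → Fin n → Fin n → Set
Succ l l′ = toℕ l′ ≡ suc (toℕ l)

ip-split : ∀ {n} (y : Pt (suc n)) {i l l′ j : Fin n} → Succ l l′ → ip y i j ≡ ip y i l ℚ.+ ip y l′ j
ip-split y {i} {l} {l′} {j} l⋖l′ =
  trans (through (y (inject₁ i)) (y (Fin.suc j)) (y (Fin.suc l)))
        (cong (λ t → (y (inject₁ i) ℚ.- y (Fin.suc l)) ℚ.+ (y t ℚ.- y (Fin.suc j))) suc≡inject₁)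
  where
  suc≡inject₁ : Fin.suc l ≡ inject₁ l′
  suc≡inject₁ = FinP.toℕ-injective (trans (sym l⋖l′) (sym (FinP.toℕ-inject₁ l′)))
  through : ∀ a b c → a ℚ.- b ≡ (a ℚ.- c) ℚ.+ (c ℚ.- b)
  through = solve 3 (λ a b c → a :- b := (a :- c) :+ (c :- b)) refl
    where open +-*-Solver

dominant⇒0≤ip : ∀ {n} {x : Pt (suc n)} → Dominant x → ∀ i j → i Fin.≤ j → 0ℚ ℚ.≤ ip x i j
dominant⇒0≤ip {n} {x} dom i j i≤j = by-distance (toℕ j ℕ.∸ toℕ i) j (sym (ℕP.m+[n∸m]≡n i≤j))
  where
  by-distance : ∀ d j → toℕ j ≡ toℕ i ℕ.+ d → 0ℚ ℚ.≤ ip x i j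
  by-distance zero j j≡i+0 with FinP.toℕ-injective (trans j≡i+0 (ℕP.+-identityʳ (toℕ i)))
  ... | refl = dom j
  by-distance (suc d) j j≡i+d+1 =
    subst (0ℚ ℚ.≤_) (sym (ip-split x j′⋖j)) (ℚP.+-mono-≤ (by-distance d j′ (FinP.toℕ-fromℕ< j′<n)) (dom j))
    where
    j≡ : toℕ j ≡ suc (toℕ i ℕ.+ d)
    j≡ = trans j≡i+d+1 (ℕP.+-suc (toℕ i) d)
    j′<n : toℕ i ℕ.+ d ℕ.< n
    j′<n = ℕP.<-trans (ℕP.≤-reflexive (sym j≡)) (FinP.toℕ<n j)
    j′ : Fin n
    j′ = fromℕ< j′<n
    j′⋖j : Succ j′ j
    j′⋖j = trans j≡ (cong suc (sym (FinP.toℕ-fromℕ< j′<n)))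

dominant⇒0<ip : ∀ {n m} {x : Pt (suc n)} → 1 ℕ.≤ m → InShiComplement m x → Dominant x →
  ∀ i j → i Fin.≤ j → 0ℚ ℚ.< ip x i j
dominant⇒0<ip {m = m} {x} 1≤m cmp dom i j i≤j with ℚP.<-cmp 0ℚ (ip x i j)
... | tri< 0<ip _ _ = 0<ip
... | tri≈ _ 0≡ip _ = ⊥-elim (cmp i j i≤j (+ 0) (-m<nonneg 1≤m ℤP.≤-refl , ℤ.+≤+ ℕ.z≤n) (sym 0≡ip))
... | tri> _ _ ip<0 = ⊥-elim (ℚP.<-irrefl refl (ℚP.<-≤-trans ip<0 (dominant⇒0≤ip {x = x} dom i j i≤j)))

dominant⇒coords-nonneg : ∀ {n m} {x y : Pt (suc n)} {c} → 1 ℕ.≤ m → InShiComplement m x → Dominant x →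
  InAlcove y c → SameRegion m x y → ∀ i j → i Fin.≤ j → + 0 ℤ.≤ c i j
dominant⇒coords-nonneg {x = x} 1≤m cmp dom yc x~y i j i≤j = ℤP.≮⇒≥ λ c<0 →
  ℚP.<-asym (dominant⇒0<ip {x = x} 1≤m cmp dom i j i≤j)
    (proj₂ (x~y i j i≤j (+ 0) (-m<nonneg 1≤m ℤP.≤-refl , ℤ.+≤+ ℕ.z≤n))
      (proj₂ (floor-<-iff (+ 0) (proj₁ (yc i j i≤j)) (proj₂ (yc i j i≤j))) c<0))

-- Shi's inequalities

alcove-split : ∀ {n} {y : Pt (suc n)} {c} → InAlcove y c → ∀ {i l l′ j} → i Fin.≤ l → l′ Fin.≤ j → Succ l l′ →
  (c i l ℤ.+ c l′ j ℤ.≤ c i j) × (c i j ℤ.≤ c i l ℤ.+ c l′ j ℤ.+ + 1)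
alcove-split {y = y} {c} yc {i} {l} {l′} {j} i≤l l′≤j l⋖l′ =
  <+1⇒≤ (floors-< (subst₂ ℚ._<_ (sym (ℤtoℚ-+ (c i l) (c l′ j))) (sym split)
                     (ℚP.+-mono-< (proj₁ il) (proj₁ l′j)))
                   (proj₂ ij)) ,
  <+1⇒≤ (subst (c i j ℤ.<_) (sum-of-successors (c i l) (c l′ j))
          (floors-< (proj₁ ij)
            (subst₂ ℚ._<_ (sym split) (sym (ℤtoℚ-+ (c i l ℤ.+ + 1) (c l′ j ℤ.+ + 1)))
              (ℚP.+-mono-< (proj₂ il) (proj₂ l′j)))))
  where
  i≤j : i Fin.≤ j
  i≤j = ℕP.≤-trans i≤l (ℕP.≤-trans (ℕP.n≤1+n (toℕ l)) (subst (ℕ._≤ toℕ j) l⋖l′ l′≤j))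
  il = yc i l i≤l
  l′j = yc l′ j l′≤j
  ij = yc i j i≤j
  split : ip y i j ≡ ip y i l ℚ.+ ip y l′ j
  split = ip-split y l⋖l′
  floors-< : ∀ {a b s} → ℤtoℚ a ℚ.< s → s ℚ.< ℤtoℚ b → a ℤ.< b
  floors-< a<s s<b = ℤtoℚ-cancel-< (ℚP.<-trans a<s s<b)
  sum-of-successors : ∀ a b → (a ℤ.+ + 1) ℤ.+ (b ℤ.+ + 1) ≡ (a ℤ.+ b ℤ.+ + 1) ℤ.+ + 1
  sum-of-successors = solve-∀

ShiAt : (ℕ → ℕ → ℕ) → ℕ → ℕ → ℕ → Set
ShiAt A a l b = (A a l ℕ.+ A (suc l) b ℕ.≤ A a b) × (A a b ℕ.≤ suc (A a l ℕ.+ A (suc l) b))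

ShiInequalities : ℕ → (ℕ → ℕ → ℕ) → Set
ShiInequalities n A = ∀ {a l b} → a ℕ.≤ l → l ℕ.< b → b ℕ.< n → ShiAt A a l b

arrayOf : ∀ {n} → (Fin n → Fin n → ℤ) → ℕ → ℕ → ℕ
arrayOf {n} c a b with a ℕ.<? n | b ℕ.<? n
... | yes a<n | yes b<n = ℤ.∣ c (fromℕ< a<n) (fromℕ< b<n) ∣
... | _ | _ = 0

coordsOf : ∀ {n} → (ℕ → ℕ → ℕ) → Fin n → Fin n → ℤ
coordsOf A i j = + A (toℕ i) (toℕ j)

arrayOf-fromℕ< : ∀ {n a b} (c : Fin n → Fin n → ℤ) (a<n : a ℕ.< n) (b<n : b ℕ.< n) →
  arrayOf c a b ≡ ℤ.∣ c (fromℕ< a<n) (fromℕ< b<n) ∣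
arrayOf-fromℕ< {n} {a} {b} c a<n b<n with a ℕ.<? n | b ℕ.<? n
... | yes _ | yes _ = refl
... | no a≮n | _ = ⊥-elim (a≮n a<n)
... | yes _ | no b≮n = ⊥-elim (b≮n b<n)

arrayOf-toℕ : ∀ {n} (c : Fin n → Fin n → ℤ) i j → arrayOf c (toℕ i) (toℕ j) ≡ ℤ.∣ c i j ∣
arrayOf-toℕ c i j = trans (arrayOf-fromℕ< c (FinP.toℕ<n i) (FinP.toℕ<n j))
  (cong₂ (λ i′ j′ → ℤ.∣ c i′ j′ ∣) (FinP.fromℕ<-toℕ i _) (FinP.fromℕ<-toℕ j _))

alcove⇒shiInequalities : ∀ {n} {y : Pt (suc n)} {c} → InAlcove y c →
  (∀ i j → i Fin.≤ j → + 0 ℤ.≤ c i j) → ShiInequalities n (arrayOf c)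
alcove⇒shiInequalities {n} {y} {c} yc c≥0 {a} {l} {b} a≤l l<b b<n =
  transport (arrayOf-fromℕ< c a<n l<n) (arrayOf-fromℕ< c l+1<n b<n) (arrayOf-fromℕ< c a<n b<n)
    (∣∣-preserves (c≥0 i l₀ i≤l₀) (c≥0 l₀+1 j l₀+1≤j) (c≥0 i j i≤j) (alcove-split {y = y} {c} yc i≤l₀ l₀+1≤j l₀⋖l₀+1))
  where
  l+1<n = ℕP.≤-<-trans l<b b<n
  l<n = ℕP.<-trans l<b b<n
  a<n = ℕP.≤-<-trans a≤l l<n
  i = fromℕ< a<n
  l₀ = fromℕ< l<n
  l₀+1 = fromℕ< l+1<n
  j = fromℕ< b<n
  i≤l₀ : i Fin.≤ l₀
  i≤l₀ = subst₂ ℕ._≤_ (sym (FinP.toℕ-fromℕ< a<n)) (sym (FinP.toℕ-fromℕ< l<n)) a≤l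
  i≤j : i Fin.≤ j
  i≤j = subst₂ ℕ._≤_ (sym (FinP.toℕ-fromℕ< a<n)) (sym (FinP.toℕ-fromℕ< b<n)) (ℕP.≤-trans a≤l (ℕP.<⇒≤ l<b))
  l₀+1≤j : l₀+1 Fin.≤ j
  l₀+1≤j = subst₂ ℕ._≤_ (sym (FinP.toℕ-fromℕ< l+1<n)) (sym (FinP.toℕ-fromℕ< b<n)) l<b
  l₀⋖l₀+1 : Succ l₀ l₀+1
  l₀⋖l₀+1 = trans (FinP.toℕ-fromℕ< l+1<n) (cong suc (sym (FinP.toℕ-fromℕ< l<n)))
  transport : ∀ {p q r p′ q′ r′} → p ≡ p′ → q ≡ q′ → r ≡ r′ →
    (p′ ℕ.+ q′ ℕ.≤ r′) × (r′ ℕ.≤ suc (p′ ℕ.+ q′)) → (p ℕ.+ q ℕ.≤ r) × (r ℕ.≤ suc (p ℕ.+ q))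
  transport refl refl refl shi = shi
  ∣∣-preserves : ∀ {p q r} → + 0 ℤ.≤ p → + 0 ℤ.≤ q → + 0 ℤ.≤ r →
    (p ℤ.+ q ℤ.≤ r) × (r ℤ.≤ p ℤ.+ q ℤ.+ + 1) →
    (ℤ.∣ p ∣ ℕ.+ ℤ.∣ q ∣ ℕ.≤ ℤ.∣ r ∣) × (ℤ.∣ r ∣ ℕ.≤ suc (ℤ.∣ p ∣ ℕ.+ ℤ.∣ q ∣))
  ∣∣-preserves {+ p} {+ q} {r} (ℤ.+≤+ _) (ℤ.+≤+ _) (ℤ.+≤+ _) (lo , hi) =
    ℤP.drop‿+≤+ lo , subst (ℤ.∣ r ∣ ℕ.≤_) (ℕP.+-comm (p ℕ.+ q) 1) (ℤP.drop‿+≤+ hi)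

-- Minimal alcoves

width-shrinks-right : ∀ {a b q d} → q ℕ.< b → b ℕ.≤ a ℕ.+ suc d → q ℕ.≤ a ℕ.+ d
width-shrinks-right {a} {d = d} q<b b≤ = ℕP.≤-pred (ℕP.≤-trans q<b (ℕP.≤-trans b≤ (ℕP.≤-reflexive (ℕP.+-suc a d))))

width-shrinks-left : ∀ {a b p d} → a ℕ.≤ p → b ℕ.≤ a ℕ.+ suc d → b ℕ.≤ suc p ℕ.+ d
width-shrinks-left {a} {d = d} a≤p b≤ = ℕP.≤-trans b≤ (ℕP.≤-trans (ℕP.≤-reflexive (ℕP.+-suc a d)) (s≤s (ℕP.+-monoˡ-≤ d a≤p)))

Tight : ℕ → (ℕ → ℕ → ℕ) → Set
Tight m A = ∀ {a b} → a ℕ.≤ b → A a b ℕ.≤ m ⊎ Σ ℕ λ l → a ℕ.≤ l × l ℕ.< b × A a b ≡ A a l ℕ.+ A (suc l) b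

tight⇒minimal : ∀ {n m A B} → Tight m A → ShiInequalities n B →
  (∀ {a b} → a ℕ.≤ b → b ℕ.< n → A a b ℕ.⊓ m ≡ B a b ℕ.⊓ m) →
  ∀ {a b} → a ℕ.≤ b → b ℕ.< n → A a b ℕ.≤ B a b
tight⇒minimal {n} {m} {A} {B} tight shiB agree {a} {b} = by-width b (ℕP.m≤n+m b a)
  where
  by-width : ∀ d {a b} → b ℕ.≤ a ℕ.+ d → a ℕ.≤ b → b ℕ.< n → A a b ℕ.≤ B a b
  by-width d {a} {b} _ a≤b b<n with tight a≤b
  ... | inj₁ A≤m = begin
    A a b               ≡⟨ ℕP.m≤n⇒m⊓n≡m A≤m ⟨
    A a b ℕ.⊓ m         ≡⟨ agree a≤b b<n ⟩
    B a b ℕ.⊓ m         ≤⟨ ℕP.m⊓n≤m _ m ⟩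
    B a b               ∎
    where open ℕP.≤-Reasoning
  by-width zero {a} b≤a+0 a≤b b<n | inj₂ (l , a≤l , l<b , _) =
    ⊥-elim (ℕP.<-irrefl refl (ℕP.≤-<-trans a≤l (ℕP.<-≤-trans l<b (ℕP.≤-trans b≤a+0 (ℕP.≤-reflexive (ℕP.+-identityʳ a))))))
  by-width (suc d) {a} {b} b≤a+d+1 a≤b b<n | inj₂ (l , a≤l , l<b , A-split) = begin
    A a b                         ≡⟨ A-split ⟩
    A a l ℕ.+ A (suc l) b         ≤⟨ ℕP.+-mono-≤ (by-width d (width-shrinks-right l<b b≤a+d+1) a≤l (ℕP.<-trans l<b b<n))
                                                 (by-width d (width-shrinks-left a≤l b≤a+d+1) l<b b<n) ⟩
    B a l ℕ.+ B (suc l) b         ≤⟨ proj₁ (shiB a≤l l<b b<n) ⟩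
    B a b                         ∎
    where open ℕP.≤-Reasoning

sum-mono : ∀ {X : Set} (xs : List X) (f g : X → ℕ) → (∀ x → f x ℕ.≤ g x) → sumℕ (map f xs) ℕ.≤ sumℕ (map g xs)
sum-mono [] f g f≤g = ℕ.z≤n
sum-mono (x ∷ xs) f g f≤g = ℕP.+-mono-≤ (f≤g x) (sum-mono xs f g f≤g)

mutual
  sepCount-mono : ∀ {n} (c c′ : Fin n → Fin n → ℤ) → (∀ i j → i Fin.≤ j → ℤ.∣ c i j ∣ ℕ.≤ ℤ.∣ c′ i j ∣) →
    sepCount c ℕ.≤ sepCount c′
  sepCount-mono {n} c c′ c≤c′ =
    sum-mono (allFin n) _ _ λ i → sum-mono (allFin n) _ _ λ j → sepCount-term-mono c c′ c≤c′ i j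

  -- The type is left to inference: it is the summand of sepCount, which Defs keeps local.
  sepCount-term-mono : ∀ {n} (c c′ : Fin n → Fin n → ℤ) → (∀ i j → i Fin.≤ j → ℤ.∣ c i j ∣ ℕ.≤ ℤ.∣ c′ i j ∣) →
    (i j : Fin n) → _
  sepCount-term-mono c c′ c≤c′ i j with i Fin.≤? j
  ... | yes i≤j = c≤c′ i j i≤j
  ... | no _ = ℕ.z≤n

Fin⇒ℕ-indexed : ∀ {n} {P : ℕ → ℕ → Set} → (∀ (i j : Fin n) → i Fin.≤ j → P (toℕ i) (toℕ j)) →
  ∀ {a b} → a ℕ.≤ b → b ℕ.< n → P a b
Fin⇒ℕ-indexed {P = P} h {a} {b} a≤b b<n =
  subst₂ P (FinP.toℕ-fromℕ< a<n) (FinP.toℕ-fromℕ< b<n)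
    (h (fromℕ< a<n) (fromℕ< b<n) (subst₂ ℕ._≤_ (sym (FinP.toℕ-fromℕ< a<n)) (sym (FinP.toℕ-fromℕ< b<n)) a≤b))
  where a<n = ℕP.≤-<-trans a≤b b<n

tight-alcove-minimal : ∀ {n m} {x w : Pt (suc n)} {G} → 1 ℕ.≤ m → InShiComplement m x → Dominant x →
  Tight m G → InAlcove w (coordsOf G) → SameRegion m x w →
  ∀ (c : Fin n → Fin n → ℤ) (y : Pt (suc n)) → InV y → InAlcove y c → SameRegion m x y →
  sepCount (coordsOf {n} G) ℕ.≤ sepCount c
tight-alcove-minimal {n} {m} {x} {w} {G} 1≤m cmp dom tight wG x~w c y _ yc x~y =
  sepCount-mono (coordsOf G) c λ i j i≤j →
    subst (G (toℕ i) (toℕ j) ℕ.≤_) (arrayOf-toℕ c i j) (G≤c i≤j (FinP.toℕ<n j))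
  where
  c≥0 : ∀ i j → i Fin.≤ j → + 0 ℤ.≤ c i j
  c≥0 = dominant⇒coords-nonneg {x = x} {y} 1≤m cmp dom yc x~y
  w~y : SameRegion m w y
  w~y = sameRegion-trans {x = w} {x} {y} (sameRegion-sym {x = x} {w} x~w) x~y
  agree : ∀ i j → i Fin.≤ j → G (toℕ i) (toℕ j) ℕ.⊓ m ≡ arrayOf c (toℕ i) (toℕ j) ℕ.⊓ m
  agree i j i≤j rewrite arrayOf-toℕ c i j = ℤP.+-injective (begin
    + G (toℕ i) (toℕ j) ℤ.⊓ + m    ≡⟨ sameSide-⊓ 1≤m (ℤ.+≤+ ℕ.z≤n) (sameRegion⇒sameSide {y = w} {y} {coordsOf G} {c} wG yc w~y i j i≤j) ⟩
    c i j ℤ.⊓ + m                  ≡⟨ cong (ℤ._⊓ + m) (ℤP.0≤i⇒+∣i∣≡i (c≥0 i j i≤j)) ⟨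
    + ℤ.∣ c i j ∣ ℤ.⊓ + m          ∎)
    where open ≡-Reasoning
  G≤c : ∀ {a b} → a ℕ.≤ b → b ℕ.< n → G a b ℕ.≤ arrayOf c a b
  G≤c = tight⇒minimal tight (alcove⇒shiInequalities {y = y} yc c≥0) (Fin⇒ℕ-indexed agree)

-- The greedy array

module Greedy (m : ℕ) (A : ℕ → ℕ → ℕ) where

  mutual
    greedy : ℕ → ℕ → ℕ → ℕ
    greedy zero a b = 0
    greedy (suc f) a b with A a b ℕ.<? m
    ... | yes _ = A a b
    ... | no _ = m ℕ.⊔ bestSplit f a b b

    bestSplit : ℕ → ℕ → ℕ → ℕ → ℕ
    bestSplit f a b zero = 0
    bestSplit f a b (suc l) with a ℕ.≤? l
    ... | yes _ = bestSplit f a b l ℕ.⊔ (greedy f a l ℕ.+ greedy f (suc l) b)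
    ... | no _ = bestSplit f a b l

  splitValue : ℕ → ℕ → ℕ → ℕ → ℕ
  splitValue f a b l = greedy f a l ℕ.+ greedy f (suc l) b

  bestSplit-≥ : ∀ f a b k l → a ℕ.≤ l → l ℕ.< k → splitValue f a b l ℕ.≤ bestSplit f a b k
  bestSplit-≥ f a b (suc k) l a≤l l<k+1 with a ℕ.≤? k | ℕP.m≤n⇒m<n∨m≡n (ℕP.≤-pred l<k+1)
  ... | yes _ | inj₁ l<k = ℕP.≤-trans (bestSplit-≥ f a b k l a≤l l<k) (ℕP.m≤m⊔n _ _)
  ... | yes _ | inj₂ refl = ℕP.m≤n⊔m _ _
  ... | no _ | inj₁ l<k = bestSplit-≥ f a b k l a≤l l<k
  ... | no a≰k | inj₂ refl = ⊥-elim (a≰k a≤l)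

  bestSplit-lub : ∀ f a b k B → (∀ l → a ℕ.≤ l → l ℕ.< k → splitValue f a b l ℕ.≤ B) → bestSplit f a b k ℕ.≤ B
  bestSplit-lub f a b zero B bound = ℕ.z≤n
  bestSplit-lub f a b (suc k) B bound with a ℕ.≤? k
  ... | yes a≤k = ℕP.⊔-lub (bestSplit-lub f a b k B bound′) (bound k a≤k ℕP.≤-refl)
    where bound′ = λ l a≤l l<k → bound l a≤l (ℕP.m≤n⇒m≤1+n l<k)
  ... | no _ = bestSplit-lub f a b k B (λ l a≤l l<k → bound l a≤l (ℕP.m≤n⇒m≤1+n l<k))

  bestSplit-attained : ∀ f a b k → bestSplit f a b k ≡ 0 ⊎
    Σ ℕ λ l → a ℕ.≤ l × l ℕ.< k × bestSplit f a b k ≡ splitValue f a b l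
  bestSplit-attained f a b zero = inj₁ refl
  bestSplit-attained f a b (suc k) with a ℕ.≤? k
  ... | no _ = Sum.map₂ (λ (l , a≤l , l<k , eq) → l , a≤l , ℕP.m≤n⇒m≤1+n l<k , eq) (bestSplit-attained f a b k)
  ... | yes a≤k with ℕP.≤-total (bestSplit f a b k) (splitValue f a b k)
  ...   | inj₁ best≤k = inj₂ (k , a≤k , ℕP.≤-refl , ℕP.m≤n⇒m⊔n≡n best≤k)
  ...   | inj₂ k≤best rewrite ℕP.m≥n⇒m⊔n≡m k≤best =
            Sum.map₂ (λ (l , a≤l , l<k , eq) → l , a≤l , ℕP.m≤n⇒m≤1+n l<k , eq) (bestSplit-attained f a b k)

  mutual
    greedy-fuel : ∀ f g a b → a ℕ.≤ b → b ℕ.∸ a ℕ.< f → b ℕ.∸ a ℕ.< g → greedy f a b ≡ greedy g a b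
    greedy-fuel (suc f) (suc g) a b a≤b w<f w<g with A a b ℕ.<? m
    ... | yes _ = refl
    ... | no _ = cong (m ℕ.⊔_) (bestSplit-fuel f g a b b ℕP.≤-refl a≤b (ℕP.≤-pred w<f) (ℕP.≤-pred w<g))

    bestSplit-fuel : ∀ f g a b k → k ℕ.≤ b → a ℕ.≤ b → b ℕ.∸ a ℕ.≤ f → b ℕ.∸ a ℕ.≤ g →
                     bestSplit f a b k ≡ bestSplit g a b k
    bestSplit-fuel f g a b zero _ _ _ _ = refl
    bestSplit-fuel f g a b (suc k) k<b a≤b w≤f w≤g with a ℕ.≤? k
    ... | no _ = bestSplit-fuel f g a b k (ℕP.<⇒≤ k<b) a≤b w≤f w≤g
    ... | yes a≤k = cong₂ ℕ._⊔_ (bestSplit-fuel f g a b k (ℕP.<⇒≤ k<b) a≤b w≤f w≤g)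
        (cong₂ ℕ._+_ (greedy-fuel f g a k a≤k (ℕP.<-≤-trans left w≤f) (ℕP.<-≤-trans left w≤g))
                     (greedy-fuel f g (suc k) b k<b (ℕP.<-≤-trans right w≤f) (ℕP.<-≤-trans right w≤g)))
      where
      left : k ℕ.∸ a ℕ.< b ℕ.∸ a
      left = ℕP.∸-monoˡ-< k<b a≤k
      right : b ℕ.∸ suc k ℕ.< b ℕ.∸ a
      right = ℕP.∸-monoʳ-< (s≤s a≤k) k<b

  G : ℕ → ℕ → ℕ
  G a b = greedy (suc (b ℕ.∸ a)) a b

  splitValue-G : ∀ {a l b} → a ℕ.≤ l → l ℕ.< b → splitValue (b ℕ.∸ a) a b l ≡ G a l ℕ.+ G (suc l) b
  splitValue-G {a} {l} {b} a≤l l<b = cong₂ ℕ._+_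
    (greedy-fuel _ _ a l a≤l (ℕP.∸-monoˡ-< l<b a≤l) ℕP.≤-refl)
    (greedy-fuel _ _ (suc l) b l<b (ℕP.∸-monoʳ-< (s≤s a≤l) l<b) ℕP.≤-refl)

  G-below : ∀ {a b} → A a b ℕ.< m → G a b ≡ A a b
  G-below {a} {b} A<m with A a b ℕ.<? m
  ... | yes _ = refl
  ... | no A≮m = ⊥-elim (A≮m A<m)

  G-above : ∀ {a b} → ¬ A a b ℕ.< m → m ℕ.≤ G a b
  G-above {a} {b} A≮m with A a b ℕ.<? m
  ... | yes A<m = ⊥-elim (A≮m A<m)
  ... | no _ = ℕP.m≤m⊔n _ _

  G-⊓ : ∀ a b → G a b ℕ.⊓ m ≡ A a b ℕ.⊓ m
  G-⊓ a b with A a b ℕ.<? m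
  ... | yes _ = refl
  ... | no A≮m = trans (ℕP.m≥n⇒m⊓n≡n (ℕP.m≤m⊔n m _)) (sym (ℕP.m≥n⇒m⊓n≡n (ℕP.≮⇒≥ A≮m)))

  G-splits-≤ : ∀ {a l b} → ¬ A a b ℕ.< m → a ℕ.≤ l → l ℕ.< b → G a l ℕ.+ G (suc l) b ℕ.≤ G a b
  G-splits-≤ {a} {l} {b} A≮m a≤l l<b with A a b ℕ.<? m
  ... | yes A<m = ⊥-elim (A≮m A<m)
  ... | no _ = ℕP.≤-trans (ℕP.≤-reflexive (sym (splitValue-G a≤l l<b)))
                 (ℕP.≤-trans (bestSplit-≥ (b ℕ.∸ a) a b b l a≤l l<b) (ℕP.m≤n⊔m m _))

  G-least : ∀ {a b B} → ¬ A a b ℕ.< m → m ℕ.≤ B →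
    (∀ l → a ℕ.≤ l → l ℕ.< b → G a l ℕ.+ G (suc l) b ℕ.≤ B) → G a b ℕ.≤ B
  G-least {a} {b} {B} A≮m m≤B bound with A a b ℕ.<? m
  ... | yes A<m = ⊥-elim (A≮m A<m)
  ... | no _ = ℕP.⊔-lub m≤B (bestSplit-lub (b ℕ.∸ a) a b b B
                 (λ l a≤l l<b → subst (ℕ._≤ B) (sym (splitValue-G a≤l l<b)) (bound l a≤l l<b)))

  G-tight : Tight m G
  G-tight {a} {b} a≤b with A a b ℕ.<? m
  ... | yes A<m = inj₁ (ℕP.<⇒≤ A<m)
  ... | no _ with bestSplit-attained (b ℕ.∸ a) a b b
  ...   | inj₁ best≡0 = inj₁ (ℕP.≤-reflexive (trans (cong (m ℕ.⊔_) best≡0) (ℕP.⊔-identityʳ m)))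
  ...   | inj₂ (l , a≤l , l<b , best≡) with ℕP.≤-total (splitValue (b ℕ.∸ a) a b l) m
  ...     | inj₁ split≤m = inj₁ (ℕP.⊔-lub ℕP.≤-refl (subst (ℕ._≤ m) (sym best≡) split≤m))
  ...     | inj₂ m≤split = inj₂ (l , a≤l , l<b ,
              trans (cong (m ℕ.⊔_) best≡) (trans (ℕP.m≤n⇒m⊔n≡n m≤split) (splitValue-G a≤l l<b)))

  module _ {n} (shiA : ShiInequalities n A) where

    shiAt-below-m : ∀ {a l b} → A a b ℕ.< m → ShiAt A a l b → ShiAt G a l b
    shiAt-below-m {a} {l} {b} A<m shi
      rewrite G-below A<m
            | G-below (ℕP.≤-<-trans (ℕP.m≤m+n (A a l) _) (ℕP.≤-<-trans (proj₁ shi) A<m))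
            | G-below (ℕP.≤-<-trans (ℕP.m≤n+m (A (suc l) b) _) (ℕP.≤-<-trans (proj₁ shi) A<m)) = shi

    m≤1+G-split : ∀ {a l b} → ¬ A a b ℕ.< m → ShiAt A a l b → m ℕ.≤ suc (G a l ℕ.+ G (suc l) b)
    m≤1+G-split {a} {l} {b} A≮m shi with m ℕ.≤? A a l | m ℕ.≤? A (suc l) b
    ... | no m≰A₁ | no m≰A₂ rewrite G-below (ℕP.≰⇒> m≰A₁) | G-below (ℕP.≰⇒> m≰A₂) =
      ℕP.≤-trans (ℕP.≮⇒≥ A≮m) (proj₂ shi)
    ... | yes m≤A₁ | _ = ℕP.≤-trans (G-above (ℕP.≤⇒≯ m≤A₁)) (ℕP.≤-trans (ℕP.m≤m+n _ _) (ℕP.n≤1+n _))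
    ... | no _ | yes m≤A₂ = ℕP.≤-trans (G-above (ℕP.≤⇒≯ m≤A₂)) (ℕP.≤-trans (ℕP.m≤n+m _ _) (ℕP.n≤1+n _))

    G-shiInequalities : ShiInequalities n G
    G-shiInequalities {a} {l} {b} = by-width b (ℕP.m≤n+m b a)
      where
      by-width : ∀ d {a l b} → b ℕ.≤ a ℕ.+ d → a ℕ.≤ l → l ℕ.< b → b ℕ.< n → ShiAt G a l b
      by-width zero {a} b≤a+0 a≤l l<b b<n =
        ⊥-elim (ℕP.<-irrefl refl (ℕP.≤-<-trans a≤l (ℕP.<-≤-trans l<b (ℕP.≤-trans b≤a+0 (ℕP.≤-reflexive (ℕP.+-identityʳ a))))))
      by-width (suc d) {a} {l} {b} b≤a+d+1 a≤l l<b b<n with m ℕ.≤? A a b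
      ... | no m≰A = shiAt-below-m (ℕP.≰⇒> m≰A) (shiA a≤l l<b b<n)
      ... | yes m≤A = G-splits-≤ A≮m a≤l l<b , G-least A≮m (m≤1+G-split A≮m (shiA a≤l l<b b<n)) any-split
        where
        A≮m = ℕP.≤⇒≯ m≤A
        open ℕP.≤-Reasoning
        reassoc₁ : ∀ x y z → x ℕ.+ suc (y ℕ.+ z) ≡ suc (x ℕ.+ y ℕ.+ z)
        reassoc₁ = ℕSolver.solve-∀
        reassoc₂ : ∀ x y z → suc (x ℕ.+ y) ℕ.+ z ≡ suc (x ℕ.+ (y ℕ.+ z))
        reassoc₂ = ℕSolver.solve-∀
        any-split : ∀ l′ → a ℕ.≤ l′ → l′ ℕ.< b → G a l′ ℕ.+ G (suc l′) b ℕ.≤ suc (G a l ℕ.+ G (suc l) b)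
        any-split l′ a≤l′ l′<b with ℕP.<-cmp l′ l
        ... | tri≈ _ refl _ = ℕP.n≤1+n _
        ... | tri< l′<l _ _ = begin
          G a l′ ℕ.+ G (suc l′) b                          ≤⟨ ℕP.+-monoʳ-≤ (G a l′) (proj₂ right) ⟩
          G a l′ ℕ.+ suc (G (suc l′) l ℕ.+ G (suc l) b)    ≡⟨ reassoc₁ (G a l′) _ _ ⟩
          suc (G a l′ ℕ.+ G (suc l′) l ℕ.+ G (suc l) b)    ≤⟨ s≤s (ℕP.+-monoˡ-≤ (G (suc l) b) (proj₁ left)) ⟩
          suc (G a l ℕ.+ G (suc l) b)                       ∎
          where
          right = by-width d (width-shrinks-left a≤l′ b≤a+d+1) l′<l l<b b<n
          left = by-width d (width-shrinks-right l<b b≤a+d+1) a≤l′ l′<l (ℕP.<-trans l<b b<n)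
        ... | tri> _ _ l<l′ = begin
          G a l′ ℕ.+ G (suc l′) b                          ≤⟨ ℕP.+-monoˡ-≤ (G (suc l′) b) (proj₂ left) ⟩
          suc (G a l ℕ.+ G (suc l) l′) ℕ.+ G (suc l′) b    ≡⟨ reassoc₂ (G a l) _ _ ⟩
          suc (G a l ℕ.+ (G (suc l) l′ ℕ.+ G (suc l′) b))  ≤⟨ s≤s (ℕP.+-monoʳ-≤ (G a l) (proj₁ right)) ⟩
          suc (G a l ℕ.+ G (suc l) b)                       ∎
          where
          left = by-width d (width-shrinks-right l′<b b≤a+d+1) a≤l l<l′ (ℕP.<-trans l′<b b<n)
          right = by-width d (width-shrinks-left a≤l b≤a+d+1) l<l′ l′<b b<n

-- Realising an array satisfying Shi's inequalities by a point

count : ∀ {P : ℕ → Set} → Decidable P → ℕ → ℕ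
count P? zero = 0
count P? (suc k) with P? k
... | yes _ = suc (count P? k)
... | no _ = count P? k

count-≤ : ∀ {P : ℕ → Set} (P? : Decidable P) k → count P? k ℕ.≤ k
count-≤ P? zero = ℕ.z≤n
count-≤ P? (suc k) with P? k
... | yes _ = s≤s (count-≤ P? k)
... | no _ = ℕP.m≤n⇒m≤1+n (count-≤ P? k)

count-mono : ∀ {P Q : ℕ → Set} (P? : Decidable P) (Q? : Decidable Q) k →
  (∀ x → x ℕ.< k → P x → Q x) → count P? k ℕ.≤ count Q? k
count-mono P? Q? zero P⇒Q = ℕ.z≤n
count-mono P? Q? (suc k) P⇒Q with P? k | Q? k
... | yes _ | yes _ = s≤s (count-mono P? Q? k (λ x x<k → P⇒Q x (ℕP.m≤n⇒m≤1+n x<k)))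
... | yes p | no ¬q = ⊥-elim (¬q (P⇒Q k ℕP.≤-refl p))
... | no _ | yes _ = ℕP.m≤n⇒m≤1+n (count-mono P? Q? k (λ x x<k → P⇒Q x (ℕP.m≤n⇒m≤1+n x<k)))
... | no _ | no _ = count-mono P? Q? k (λ x x<k → P⇒Q x (ℕP.m≤n⇒m≤1+n x<k))

count-mono-< : ∀ {P Q : ℕ → Set} (P? : Decidable P) (Q? : Decidable Q) k →
  (∀ x → x ℕ.< k → P x → Q x) → ∀ {x₀} → x₀ ℕ.< k → Q x₀ → ¬ P x₀ → count P? k ℕ.< count Q? k
count-mono-< P? Q? (suc k) P⇒Q {x₀} x₀<k+1 q ¬p with ℕP.m≤n⇒m<n∨m≡n (ℕP.≤-pred x₀<k+1) | P? k | Q? k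
... | inj₂ refl | yes p | _ = ⊥-elim (¬p p)
... | inj₂ refl | no _ | no ¬q = ⊥-elim (¬q q)
... | inj₂ refl | no _ | yes _ = s≤s (count-mono P? Q? k (λ x x<k → P⇒Q x (ℕP.m≤n⇒m≤1+n x<k)))
... | inj₁ x₀<k | yes _ | yes _ = s≤s (count-mono-< P? Q? k (λ x x<k → P⇒Q x (ℕP.m≤n⇒m≤1+n x<k)) x₀<k q ¬p)
... | inj₁ x₀<k | yes p | no ¬q = ⊥-elim (¬q (P⇒Q k ℕP.≤-refl p))
... | inj₁ x₀<k | no _ | yes _ = ℕP.m≤n⇒m≤1+n (count-mono-< P? Q? k (λ x x<k → P⇒Q x (ℕP.m≤n⇒m≤1+n x<k)) x₀<k q ¬p)
... | inj₁ x₀<k | no _ | no _ = count-mono-< P? Q? k (λ x x<k → P⇒Q x (ℕP.m≤n⇒m≤1+n x<k)) x₀<k q ¬p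

ℤtoℚ-as-/1+ : ∀ k d → ℤtoℚ (+ k) ≡ (+ (suc d ℕ.* k)) /1+ d
ℤtoℚ-as-/1+ k d = trans (/1+-expand (+ k) d)
  (cong (_/1+ d) (trans (sym (ℤP.pos-* k (suc d))) (cong +_ (ℕP.*-comm k (suc d)))))

add-sub : ∀ x y → x ℤ.+ y ℤ.- y ≡ x
add-sub = solve-∀

+-<⇒<-diff : ∀ {p q r} → p ℕ.+ q ℕ.< r → + p ℤ.< + r ℤ.- + q
+-<⇒<-diff {p} {q} {r} p+q<r =
  subst (ℤ._< + r ℤ.- + q) (add-sub (+ p) (+ q)) (ℤP.+-monoˡ-< (ℤ.- + q) (ℤ.+<+ p+q<r))

<-+⇒diff-< : ∀ {p q r} → r ℕ.< p ℕ.+ q → + r ℤ.- + q ℤ.< + p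
<-+⇒diff-< {p} {q} {r} r<p+q =
  subst (+ r ℤ.- + q ℤ.<_) (add-sub (+ p) (+ q)) (ℤP.+-monoˡ-< (ℤ.- + q) (ℤ.+<+ r<p+q))

within-one : ∀ {x y} → x ℕ.≤ y → y ℕ.≤ suc x → (y ≡ x ℕ.+ (y ℕ.∸ x)) × (y ℕ.∸ x ℕ.≤ 1)
within-one {x} {y} x≤y y≤1+x =
  sym (ℕP.m+[n∸m]≡n x≤y) , ℕP.≤-trans (ℕP.∸-monoˡ-≤ x y≤1+x) (ℕP.≤-reflexive (ℕP.m+n∸n≡m 1 x))

bit≡suc⇒0 : ∀ {e d} → e ℕ.≤ 1 → e ≡ suc d → d ≡ 0
bit≡suc⇒0 {d = zero} _ _ = refl
bit≡suc⇒0 {d = suc d} (s≤s e≤0) refl with e≤0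
... | ()

suc≡bit⇒1 : ∀ {e d} → d ℕ.≤ 1 → suc e ≡ d → d ≡ 1
suc≡bit⇒1 {zero} _ refl = refl
suc≡bit⇒1 {suc e} (s≤s ()) refl

bits-sum-2 : ∀ {e d} → e ℕ.≤ 1 → d ℕ.≤ 1 → e ℕ.+ d ≡ 2 → d ≡ 1
bits-sum-2 {zero} {suc zero} _ _ _ = refl
bits-sum-2 {suc zero} {suc zero} _ _ _ = refl
bits-sum-2 {zero} {suc (suc _)} _ (s≤s ()) _
bits-sum-2 {suc zero} {suc (suc _)} _ (s≤s ()) _
bits-sum-2 {suc (suc _)} (s≤s ()) _ _
bits-sum-2 {zero} {zero} _ _ ()
bits-sum-2 {suc zero} {zero} _ _ ()

bit-cases : ∀ {d} → d ℕ.≤ 1 → d ≡ 0 ⊎ d ≡ 1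
bit-cases {zero} _ = inj₁ refl
bit-cases {suc zero} _ = inj₂ refl
bit-cases {suc (suc _)} (s≤s ())

-- The point has coordinate −(height b + frac b) at vertex b ∈ {0, …, n}. For a < b the heights
-- differ by C a b plus carry a b ∈ {0, 1}, so frac a < frac b is forced when the carry is 0 and
-- frac a > frac b when it is 1. By the cocycle identity this prescribes a strict order ≺, and
-- ranks in ≺, divided by M, serve as the fractional parts.
module Realisation {n : ℕ} (A : ℕ → ℕ → ℕ) (shiA : ShiInequalities n A) where

  height : ℕ → ℕ
  height zero = 0
  height (suc b) = A 0 b

  C : ℕ → ℕ → ℕ
  C a b = A a (ℕ.pred b)

  carry : ℕ → ℕ → ℕ
  carry a b = height b ℕ.∸ (height a ℕ.+ C a b)

  excess : ℕ → ℕ → ℕ → ℕ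
  excess a b c = C a c ℕ.∸ (C a b ℕ.+ C b c)

  carry-spec : ∀ {a b} → a ℕ.< b → b ℕ.≤ n → (height b ≡ height a ℕ.+ C a b ℕ.+ carry a b) × (carry a b ℕ.≤ 1)
  carry-spec {zero} {suc b} _ _ = within-one ℕP.≤-refl (ℕP.n≤1+n _)
  carry-spec {suc a} {suc b} (s≤s a<b) b<n = within-one (proj₁ shi) (proj₂ shi)
    where shi = shiA ℕ.z≤n a<b b<n

  excess-spec : ∀ {a b c} → a ℕ.< b → b ℕ.< c → c ℕ.≤ n →
    (C a c ≡ C a b ℕ.+ C b c ℕ.+ excess a b c) × (excess a b c ℕ.≤ 1)
  excess-spec {a} {suc b} {suc c} (s≤s a≤b) (s≤s b<c) c<n = within-one (proj₁ shi) (proj₂ shi)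
    where shi = shiA a≤b b<c c<n

  carry≤1 : ∀ {a b} → a ℕ.< b → b ℕ.≤ n → carry a b ℕ.≤ 1
  carry≤1 a<b b≤n = proj₂ (carry-spec a<b b≤n)

  excess≤1 : ∀ {a b c} → a ℕ.< b → b ℕ.< c → c ℕ.≤ n → excess a b c ℕ.≤ 1
  excess≤1 a<b b<c c≤n = proj₂ (excess-spec a<b b<c c≤n)

  cocycle : ∀ {a b c} → a ℕ.< b → b ℕ.< c → c ℕ.≤ n → excess a b c ℕ.+ carry a c ≡ carry a b ℕ.+ carry b c
  cocycle {a} {b} {c} a<b b<c c≤n = ℕP.+-cancelˡ-≡ (height a ℕ.+ C a b ℕ.+ C b c) _ _ (begin
    height a ℕ.+ C a b ℕ.+ C b c ℕ.+ (excess a b c ℕ.+ carry a c)    ≡⟨ regroup₁ (height a) _ _ _ _ ⟩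
    height a ℕ.+ (C a b ℕ.+ C b c ℕ.+ excess a b c) ℕ.+ carry a c    ≡⟨ cong (λ t → height a ℕ.+ t ℕ.+ carry a c) (sym (proj₁ abc)) ⟩
    height a ℕ.+ C a c ℕ.+ carry a c                                 ≡⟨ sym (proj₁ (carry-spec a<c c≤n)) ⟩
    height c                                                        ≡⟨ proj₁ (carry-spec b<c c≤n) ⟩
    height b ℕ.+ C b c ℕ.+ carry b c                                 ≡⟨ cong (λ t → t ℕ.+ C b c ℕ.+ carry b c) (proj₁ (carry-spec a<b b≤n)) ⟩
    height a ℕ.+ C a b ℕ.+ carry a b ℕ.+ C b c ℕ.+ carry b c         ≡⟨ regroup₂ (height a) _ _ _ _ ⟩
    height a ℕ.+ C a b ℕ.+ C b c ℕ.+ (carry a b ℕ.+ carry b c)       ∎)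
    where
    open ≡-Reasoning
    b≤n = ℕP.≤-trans (ℕP.<⇒≤ b<c) c≤n
    a<c = ℕP.<-trans a<b b<c
    abc = excess-spec a<b b<c c≤n
    regroup₁ : ∀ h x y e d → h ℕ.+ x ℕ.+ y ℕ.+ (e ℕ.+ d) ≡ h ℕ.+ (x ℕ.+ y ℕ.+ e) ℕ.+ d
    regroup₁ = ℕSolver.solve-∀
    regroup₂ : ∀ h x d y d′ → h ℕ.+ x ℕ.+ d ℕ.+ y ℕ.+ d′ ≡ h ℕ.+ x ℕ.+ y ℕ.+ (d ℕ.+ d′)
    regroup₂ = ℕSolver.solve-∀

  _≺_ : ℕ → ℕ → Set
  a ≺ b = (a ℕ.< b × carry a b ≡ 0) ⊎ (b ℕ.< a × carry b a ≡ 1)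

  _≺?_ : ∀ a b → Dec (a ≺ b)
  a ≺? b = ((a ℕ.<? b) ×-dec (carry a b ℕ.≟ 0)) ⊎-dec ((b ℕ.<? a) ×-dec (carry b a ℕ.≟ 1))

  ≺-irrefl : ∀ {a} → ¬ a ≺ a
  ≺-irrefl (inj₁ (a<a , _)) = ℕP.<-irrefl refl a<a
  ≺-irrefl (inj₂ (a<a , _)) = ℕP.<-irrefl refl a<a

  ≺-trans : ∀ {a b c} → a ℕ.≤ n → b ℕ.≤ n → c ℕ.≤ n → a ≺ b → b ≺ c → a ≺ c
  ≺-trans {a} {b} {c} a≤n b≤n c≤n (inj₁ (a<b , Dab≡0)) (inj₁ (b<c , Dbc≡0)) =
    inj₁ (ℕP.<-trans a<b b<c , ℕP.m+n≡0⇒n≡0 (excess a b c) (trans (cocycle a<b b<c c≤n) (cong₂ ℕ._+_ Dab≡0 Dbc≡0)))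
  ≺-trans {a} {b} {c} a≤n b≤n c≤n (inj₁ (a<b , Dab≡0)) (inj₂ (c<b , Dcb≡1)) with ℕP.<-cmp a c
  ... | tri< a<c _ _ = inj₁ (a<c , bit≡suc⇒0 (excess≤1 a<c c<b b≤n) (begin
    excess a c b                   ≡⟨ sym (ℕP.+-identityʳ _) ⟩
    excess a c b ℕ.+ 0             ≡⟨ cong (excess a c b ℕ.+_) (sym Dab≡0) ⟩
    excess a c b ℕ.+ carry a b     ≡⟨ cocycle a<c c<b b≤n ⟩
    carry a c ℕ.+ carry c b        ≡⟨ cong (carry a c ℕ.+_) Dcb≡1 ⟩
    carry a c ℕ.+ 1                ≡⟨ ℕP.+-comm (carry a c) 1 ⟩
    suc (carry a c)                ∎))
    where open ≡-Reasoning
  ... | tri≈ _ refl _ = ⊥-elim (ℕP.0≢1+n (trans (sym Dab≡0) Dcb≡1))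
  ... | tri> _ _ c<a = inj₂ (c<a , suc≡bit⇒1 (carry≤1 c<a a≤n) (begin
    suc (excess c a b)             ≡⟨ ℕP.+-comm 1 _ ⟩
    excess c a b ℕ.+ 1             ≡⟨ cong (excess c a b ℕ.+_) (sym Dcb≡1) ⟩
    excess c a b ℕ.+ carry c b     ≡⟨ cocycle c<a a<b b≤n ⟩
    carry c a ℕ.+ carry a b        ≡⟨ cong (carry c a ℕ.+_) Dab≡0 ⟩
    carry c a ℕ.+ 0                ≡⟨ ℕP.+-identityʳ _ ⟩
    carry c a                      ∎))
    where open ≡-Reasoning
  ≺-trans {a} {b} {c} a≤n b≤n c≤n (inj₂ (b<a , Dba≡1)) (inj₁ (b<c , Dbc≡0)) with ℕP.<-cmp a c
  ... | tri< a<c _ _ = inj₁ (a<c , bit≡suc⇒0 (excess≤1 b<a a<c c≤n) (begin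
    excess b a c                   ≡⟨ sym (ℕP.+-identityʳ _) ⟩
    excess b a c ℕ.+ 0             ≡⟨ cong (excess b a c ℕ.+_) (sym Dbc≡0) ⟩
    excess b a c ℕ.+ carry b c     ≡⟨ cocycle b<a a<c c≤n ⟩
    carry b a ℕ.+ carry a c        ≡⟨ cong (ℕ._+ carry a c) Dba≡1 ⟩
    suc (carry a c)                ∎))
    where open ≡-Reasoning
  ... | tri≈ _ refl _ = ⊥-elim (ℕP.0≢1+n (trans (sym Dbc≡0) Dba≡1))
  ... | tri> _ _ c<a = inj₂ (c<a , suc≡bit⇒1 (carry≤1 c<a a≤n) (begin
    suc (excess b c a)             ≡⟨ ℕP.+-comm 1 _ ⟩
    excess b c a ℕ.+ 1             ≡⟨ cong (excess b c a ℕ.+_) (sym Dba≡1) ⟩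
    excess b c a ℕ.+ carry b a     ≡⟨ cocycle b<c c<a a≤n ⟩
    carry b c ℕ.+ carry c a        ≡⟨ cong (ℕ._+ carry c a) Dbc≡0 ⟩
    carry c a                      ∎))
    where open ≡-Reasoning
  ≺-trans {a} {b} {c} a≤n b≤n c≤n (inj₂ (b<a , Dba≡1)) (inj₂ (c<b , Dcb≡1)) =
    inj₂ (c<a , bits-sum-2 (excess≤1 c<b b<a a≤n) (carry≤1 c<a a≤n)
                  (trans (cocycle c<b b<a a≤n) (cong₂ ℕ._+_ Dcb≡1 Dba≡1)))
    where c<a = ℕP.<-trans c<b b<a

  rank : ℕ → ℕ
  rank b = count (_≺? b) (suc n)

  M : ℕ
  M = suc (suc n)

  rank<M : ∀ b → rank b ℕ.< M
  rank<M b = s≤s (count-≤ (_≺? b) (suc n))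

  ≺⇒rank< : ∀ {a b} → a ℕ.≤ n → b ℕ.≤ n → a ≺ b → rank a ℕ.< rank b
  ≺⇒rank< {a} {b} a≤n b≤n a≺b = count-mono-< (_≺? a) (_≺? b) (suc n)
    (λ x x<n+1 x≺a → ≺-trans (ℕP.≤-pred x<n+1) a≤n b≤n x≺a a≺b) (s≤s a≤n) a≺b ≺-irrefl

  carry-rank : ∀ {a b} → a ℕ.< b → b ℕ.≤ n →
    (rank a ℕ.< M ℕ.* carry a b ℕ.+ rank b) × (M ℕ.* carry a b ℕ.+ rank b ℕ.< rank a ℕ.+ M)
  carry-rank {a} {b} a<b b≤n = by-bit (bit-cases (carry≤1 a<b b≤n))
    where
    a≤n = ℕP.≤-trans (ℕP.<⇒≤ a<b) b≤n
    with-offset : ∀ {t} → M ℕ.* carry a b ≡ t → (rank a ℕ.< t ℕ.+ rank b) × (t ℕ.+ rank b ℕ.< rank a ℕ.+ M) →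
      (rank a ℕ.< M ℕ.* carry a b ℕ.+ rank b) × (M ℕ.* carry a b ℕ.+ rank b ℕ.< rank a ℕ.+ M)
    with-offset refl bounds = bounds
    by-bit : carry a b ≡ 0 ⊎ carry a b ≡ 1 →
      (rank a ℕ.< M ℕ.* carry a b ℕ.+ rank b) × (M ℕ.* carry a b ℕ.+ rank b ℕ.< rank a ℕ.+ M)
    by-bit (inj₁ D≡0) = with-offset (trans (cong (M ℕ.*_) D≡0) (ℕP.*-zeroʳ M))
      (≺⇒rank< a≤n b≤n (inj₁ (a<b , D≡0)) , ℕP.<-≤-trans (rank<M b) (ℕP.m≤n+m M (rank a)))
    by-bit (inj₂ D≡1) = with-offset (trans (cong (M ℕ.*_) D≡1) (ℕP.*-identityʳ M))
      (ℕP.<-≤-trans (rank<M a) (ℕP.m≤m+n M (rank b)) ,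
       subst (M ℕ.+ rank b ℕ.<_) (ℕP.+-comm M (rank a)) (ℕP.+-monoʳ-< M (≺⇒rank< b≤n a≤n (inj₂ (a<b , D≡1)))))

  Z : ℕ → ℕ
  Z b = M ℕ.* height b ℕ.+ rank b

  Z-bounds : ∀ {a b} → a ℕ.< b → b ℕ.≤ n →
    (+ (M ℕ.* C a b) ℤ.< + Z b ℤ.- + Z a) × (+ Z b ℤ.- + Z a ℤ.< + (M ℕ.* C a b ℕ.+ M))
  Z-bounds {a} {b} a<b b≤n =
    +-<⇒<-diff (subst₂ ℕ._<_ (sym (regroup₂ M (height a) (C a b) (rank a))) (sym Zb)
                  (ℕP.+-monoʳ-< X (proj₁ (carry-rank a<b b≤n)))) ,
    <-+⇒diff-< (subst₂ ℕ._<_ (sym Zb) (sym (regroup₃ M (height a) (C a b) (rank a)))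
                  (ℕP.+-monoʳ-< X (proj₂ (carry-rank a<b b≤n))))
    where
    X = M ℕ.* height a ℕ.+ M ℕ.* C a b
    regroup₁ : ∀ M h c d r → M ℕ.* (h ℕ.+ c ℕ.+ d) ℕ.+ r ≡ (M ℕ.* h ℕ.+ M ℕ.* c) ℕ.+ (M ℕ.* d ℕ.+ r)
    regroup₁ = ℕSolver.solve-∀
    regroup₂ : ∀ M h c r → M ℕ.* c ℕ.+ (M ℕ.* h ℕ.+ r) ≡ (M ℕ.* h ℕ.+ M ℕ.* c) ℕ.+ r
    regroup₂ = ℕSolver.solve-∀
    regroup₃ : ∀ M h c r → (M ℕ.* c ℕ.+ M) ℕ.+ (M ℕ.* h ℕ.+ r) ≡ (M ℕ.* h ℕ.+ M ℕ.* c) ℕ.+ (r ℕ.+ M)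
    regroup₃ = ℕSolver.solve-∀
    Zb : Z b ≡ X ℕ.+ (M ℕ.* carry a b ℕ.+ rank b)
    Zb = trans (cong (λ h → M ℕ.* h ℕ.+ rank b) (proj₁ (carry-spec a<b b≤n)))
               (regroup₁ M (height a) (C a b) (carry a b) (rank b))

  vertex : Pt (suc n)
  vertex b = (ℤ.- + Z (toℕ b)) /1+ suc n

  ip-vertex : ∀ i j → ip vertex i j ≡ (+ Z (suc (toℕ j)) ℤ.- + Z (toℕ i)) /1+ suc n
  ip-vertex i j = begin
    (ℤ.- + Z (toℕ (inject₁ i))) /1+ suc n ℚ.- (ℤ.- + Z (suc (toℕ j))) /1+ suc n
      ≡⟨ cong₂ (λ t u → t /1+ suc n ℚ.+ u) (cong (λ a → ℤ.- + Z a) (FinP.toℕ-inject₁ i)) (/1+-neg (ℤ.- + Z (suc (toℕ j))) (suc n)) ⟩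
    (ℤ.- + Z (toℕ i)) /1+ suc n ℚ.+ (ℤ.- (ℤ.- + Z (suc (toℕ j)))) /1+ suc n
      ≡⟨ /1+-+ (ℤ.- + Z (toℕ i)) (ℤ.- (ℤ.- + Z (suc (toℕ j)))) (suc n) ⟩
    (ℤ.- + Z (toℕ i) ℤ.+ ℤ.- (ℤ.- + Z (suc (toℕ j)))) /1+ suc n
      ≡⟨ cong (_/1+ suc n) (swap (+ Z (toℕ i)) (+ Z (suc (toℕ j)))) ⟩
    (+ Z (suc (toℕ j)) ℤ.- + Z (toℕ i)) /1+ suc n ∎
    where
    open ≡-Reasoning
    swap : ∀ x y → ℤ.- x ℤ.+ ℤ.- (ℤ.- y) ≡ y ℤ.- x
    swap = solve-∀

  vertex-alcove : InAlcove vertex (coordsOf A)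
  vertex-alcove i j i≤j =
    subst₂ ℚ._<_ (sym (ℤtoℚ-as-/1+ (A (toℕ i) (toℕ j)) (suc n))) (sym (ip-vertex i j))
      (/1+-mono-< (suc n) (proj₁ bounds)) ,
    subst₂ ℚ._<_ (sym (ip-vertex i j)) (sym upper-as-/1+)
      (/1+-mono-< (suc n) (proj₂ bounds))
    where
    bounds = Z-bounds (s≤s i≤j) (FinP.toℕ<n j)
    times-succ : ∀ M a → M ℕ.* (a ℕ.+ 1) ≡ M ℕ.* a ℕ.+ M
    times-succ = ℕSolver.solve-∀
    upper-as-/1+ : ℤtoℚ (coordsOf A i j ℤ.+ + 1) ≡ (+ (M ℕ.* A (toℕ i) (toℕ j) ℕ.+ M)) /1+ suc n
    upper-as-/1+ = trans (ℤtoℚ-as-/1+ (A (toℕ i) (toℕ j) ℕ.+ 1) (suc n))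
                         (cong (λ t → (+ t) /1+ suc n) (times-succ M (A (toℕ i) (toℕ j))))

recentre : ∀ {N} → Pt (suc N) → Pt (suc N)
recentre {N} v b = v b ℚ.- sumℚ v ℚ.* ((+ 1) /1+ N)

sum-pointwise-sub : ∀ {N} (bs : List (Fin N)) (v : Pt N) μ →
  foldr ℚ._+_ 0ℚ (map (λ b → v b ℚ.- μ) bs) ≡ foldr ℚ._+_ 0ℚ (map v bs) ℚ.- μ ℚ.* ℤtoℚ (+ length bs)
sum-pointwise-sub [] v μ = sym (trans (cong (λ t → 0ℚ ℚ.- t) (ℚP.*-zeroʳ μ)) (ℚP.+-inverseʳ 0ℚ))
sum-pointwise-sub (b ∷ bs) v μ = begin
  (v b ℚ.- μ) ℚ.+ foldr ℚ._+_ 0ℚ (map (λ b → v b ℚ.- μ) bs)     ≡⟨ cong ((v b ℚ.- μ) ℚ.+_) (sum-pointwise-sub bs v μ) ⟩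
  (v b ℚ.- μ) ℚ.+ (S ℚ.- μ ℚ.* ℤtoℚ (+ length bs))               ≡⟨ regroup (v b) S μ (ℤtoℚ (+ length bs)) ⟩
  (v b ℚ.+ S) ℚ.- μ ℚ.* (ℚ.1ℚ ℚ.+ ℤtoℚ (+ length bs))            ≡⟨ cong (λ t → (v b ℚ.+ S) ℚ.- μ ℚ.* t) (sym (ℤtoℚ-+ (+ 1) (+ length bs))) ⟩
  (v b ℚ.+ S) ℚ.- μ ℚ.* ℤtoℚ (+ suc (length bs))                 ∎
  where
  open ≡-Reasoning
  S = foldr ℚ._+_ 0ℚ (map v bs)
  regroup : ∀ a s μ t → (a ℚ.- μ) ℚ.+ (s ℚ.- μ ℚ.* t) ≡ (a ℚ.+ s) ℚ.- μ ℚ.* (ℚ.1ℚ ℚ.+ t)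
  regroup = solve 4 (λ a s μ t → (a :- μ) :+ (s :- μ :* t) := (a :+ s) :- μ :* (con ℚ.1ℚ :+ t)) refl
    where open +-*-Solver

inverse-of-succ : ∀ N → (+ 1) /1+ N ℚ.* ℤtoℚ (+ suc N) ≡ ℚ.1ℚ
inverse-of-succ N = ℚP.toℚᵘ-injective (begin
  ℚ.toℚᵘ ((+ 1) /1+ N ℚ.* ℤtoℚ (+ suc N))               ≈⟨ ℚP.toℚᵘ-homo-* ((+ 1) /1+ N) (ℤtoℚ (+ suc N)) ⟩
  ℚ.toℚᵘ ((+ 1) /1+ N) ℚᵘ.* ℚ.toℚᵘ (ℤtoℚ (+ suc N))     ≈⟨ ℚᵘP.*-cong (toℚᵘ-/1+ (+ 1) N) (toℚᵘ-/1+ (+ suc N) 0) ⟩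
  mkℚᵘ (+ 1) N ℚᵘ.* mkℚᵘ (+ suc N) 0                    ≈⟨ *≡* (trans (ℤP.*-identityʳ _) (trans (ℤP.*-identityˡ (+ suc N))
                                                             (sym (trans (ℤP.*-identityˡ _) (cong +_ (ℕP.*-identityʳ (suc N))))))) ⟩
  mkℚᵘ (+ 1) 0                                          ≈⟨ toℚᵘ-/1+ (+ 1) 0 ⟨
  ℚ.toℚᵘ ℚ.1ℚ                                           ∎)
  where open SetoidReasoning ℚᵘP.≃-setoid

recentre-InV : ∀ {N} (v : Pt (suc N)) → InV (recentre v)
recentre-InV {N} v = begin
  sumℚ (recentre v)                                        ≡⟨ sum-pointwise-sub (allFin (suc N)) v μ ⟩
  S ℚ.- μ ℚ.* ℤtoℚ (+ length (allFin (suc N)))             ≡⟨ cong (λ t → S ℚ.- μ ℚ.* ℤtoℚ (+ t)) (ListP.length-tabulate {n = suc N} (λ b → b)) ⟩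
  S ℚ.- μ ℚ.* ℤtoℚ (+ suc N)                               ≡⟨ cong (λ t → S ℚ.- t) (ℚP.*-assoc S _ _) ⟩
  S ℚ.- S ℚ.* ((+ 1) /1+ N ℚ.* ℤtoℚ (+ suc N))             ≡⟨ cong (λ t → S ℚ.- S ℚ.* t) (inverse-of-succ N) ⟩
  S ℚ.- S ℚ.* ℚ.1ℚ                                         ≡⟨ cong (λ t → S ℚ.- t) (ℚP.*-identityʳ S) ⟩
  S ℚ.- S                                                  ≡⟨ ℚP.+-inverseʳ S ⟩
  0ℚ                                                       ∎
  where
  open ≡-Reasoning
  S = sumℚ v
  μ = S ℚ.* ((+ 1) /1+ N)

ip-recentre : ∀ {n} (v : Pt (suc n)) i j → ip (recentre v) i j ≡ ip v i j
ip-recentre {n} v i j = shift-cancels (v (inject₁ i)) (v (Fin.suc j)) (sumℚ v ℚ.* ((+ 1) /1+ n))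
  where
  shift-cancels : ∀ a b μ → (a ℚ.- μ) ℚ.- (b ℚ.- μ) ≡ a ℚ.- b
  shift-cancels = solve 3 (λ a b μ → (a :- μ) :- (b :- μ) := a :- b) refl
    where open +-*-Solver

recentre-alcove : ∀ {n} {v : Pt (suc n)} {c} → InAlcove v c → InAlcove (recentre v) c
recentre-alcove {v = v} {c} vc i j i≤j =
  subst (λ s → (ℤtoℚ (c i j) ℚ.< s) × (s ℚ.< ℤtoℚ (c i j ℤ.+ + 1))) (sym (ip-recentre v i j)) (vc i j i≤j)

shiInequalities⇒alcove : ∀ {n A} → ShiInequalities n A →
  Σ (Pt (suc n)) λ v → InV v × InAlcove v (coordsOf A)
shiInequalities⇒alcove {n} {A} shiA = recentre vertex , recentre-InV vertex , recentre-alcove {v = vertex} {coordsOf A} vertex-alcove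
  where open Realisation {n} A shiA

-- Forgetting the last coordinate

inject₁-mono : ∀ {n} {i j : Fin n} → i Fin.≤ j → inject₁ i Fin.≤ inject₁ j
inject₁-mono {i = i} {j} = subst₂ ℕ._≤_ (sym (FinP.toℕ-inject₁ i)) (sym (FinP.toℕ-inject₁ j))

recentre-sameRegion : ∀ {n m} {v y : Pt (suc n)} → SameRegion m v y → SameRegion m (recentre v) y
recentre-sameRegion {v = v} {y} v~y i j i≤j k k∈R =
  subst (λ s → (s ℚ.< ℤtoℚ k → ip y i j ℚ.< ℤtoℚ k) × (ip y i j ℚ.< ℤtoℚ k → s ℚ.< ℤtoℚ k))
    (sym (ip-recentre v i j)) (v~y i j i≤j k k∈R)

restrict : ∀ {n} → Pt (suc (suc n)) → Pt (suc n)
restrict x = recentre (x ∘ inject₁)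

restrict-complement : ∀ {n m} {x : Pt (suc (suc n))} → InShiComplement m x → InShiComplement m (restrict x)
restrict-complement {x = x} cmp i j i≤j k k∈R =
  cmp (inject₁ i) (inject₁ j) (inject₁-mono i≤j) k k∈R ∘ trans (sym (ip-recentre (x ∘ inject₁) i j))

restrict-dominant : ∀ {n} {x : Pt (suc (suc n))} → Dominant x → Dominant (restrict x)
restrict-dominant {x = x} dom i = subst (0ℚ ℚ.≤_) (sym (ip-recentre (x ∘ inject₁) i i)) (dom (inject₁ i))

restrict-sameRegion : ∀ {n m} {x y : Pt (suc (suc n))} {w : Pt (suc n)} {c c′} →
  SameRegion m x y → InAlcove y c → InAlcove w c′ →
  (∀ i j → i Fin.≤ j → c (inject₁ i) (inject₁ j) ℤ.⊓ + m ≡ c′ i j ℤ.⊓ + m) → SameRegion m (restrict x) w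
restrict-sameRegion {x = x} {y} {w} {c} {c′} x~y yc wc′ agree =
  recentre-sameRegion {v = x ∘ inject₁} {w} (sameRegion-trans {x = x ∘ inject₁} {y ∘ inject₁} {w} x′~y′ y′~w)
  where
  x′~y′ : SameRegion _ (x ∘ inject₁) (y ∘ inject₁)
  x′~y′ i j i≤j = x~y (inject₁ i) (inject₁ j) (inject₁-mono i≤j)
  y′c : InAlcove (y ∘ inject₁) (λ i j → c (inject₁ i) (inject₁ j))
  y′c i j i≤j = yc (inject₁ i) (inject₁ j) (inject₁-mono i≤j)
  y′~w : SameRegion _ (y ∘ inject₁) w
  y′~w = sameSide⇒sameRegion {y = y ∘ inject₁} {w} {λ i j → c (inject₁ i) (inject₁ j)} {c′} y′c wc′
           λ i j i≤j → ⊓-sameSide (agree i j i≤j)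

greedy-⊓-restrict : ∀ {n} m (c : Fin (suc n) → Fin (suc n) → ℤ) → (∀ i j → i Fin.≤ j → + 0 ℤ.≤ c i j) →
  ∀ (i j : Fin n) → i Fin.≤ j → c (inject₁ i) (inject₁ j) ℤ.⊓ + m ≡ coordsOf (Greedy.G m (arrayOf c)) i j ℤ.⊓ + m
greedy-⊓-restrict m c c≥0 i j i≤j = begin
  c (inject₁ i) (inject₁ j) ℤ.⊓ + m
    ≡⟨ cong (ℤ._⊓ + m) (ℤP.0≤i⇒+∣i∣≡i (c≥0 _ _ (inject₁-mono i≤j))) ⟨
  + (ℤ.∣ c (inject₁ i) (inject₁ j) ∣ ℕ.⊓ m)
    ≡⟨ cong (λ a → + (a ℕ.⊓ m)) (arrayOf-toℕ c (inject₁ i) (inject₁ j)) ⟨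
  + (arrayOf c (toℕ (inject₁ i)) (toℕ (inject₁ j)) ℕ.⊓ m)
    ≡⟨ cong₂ (λ a b → + (arrayOf c a b ℕ.⊓ m)) (FinP.toℕ-inject₁ i) (FinP.toℕ-inject₁ j) ⟩
  + (arrayOf c (toℕ i) (toℕ j) ℕ.⊓ m)
    ≡⟨ cong +_ (Greedy.G-⊓ m (arrayOf c) (toℕ i) (toℕ j)) ⟨
  coordsOf (Greedy.G m (arrayOf c)) i j ℤ.⊓ + m
    ∎
  where open ≡-Reasoning

lemma5p1 : (k m : ℕ) → 1 ℕ.≤ k → 1 ℕ.≤ m →
    (x : Pt (suc (suc k))) → InV x → InShiComplement m x → Dominant x →
    (T : Fin (suc k) → Fin (suc k) → ℤ) → IsShiTableau m x T →
    Σ (Pt (suc k)) λ x′ → InV x′ × InShiComplement m x′ × Dominant x′ ×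
      IsShiTableau m x′ (λ i j → T (inject₁ i) (inject₁ j))
lemma5p1 k m _ 1≤m x _ cmp dom T (c , y , _ , yc , x~y , _ , T≡c⊓m) =
  restrict x , recentre-InV (x ∘ inject₁) , cmp′ , dom′ ,
  (coordsOf G , w , proj₁ (proj₂ realised) , wG , x′~w ,
   tight-alcove-minimal {x = restrict x} {w} 1≤m cmp′ dom′ G-tight wG x′~w , tableau)
  where
  open Greedy m (arrayOf c)
  c≥0 = dominant⇒coords-nonneg {x = x} {y} 1≤m cmp dom yc x~y
  agree = greedy-⊓-restrict m c c≥0
  realised = shiInequalities⇒alcove {k} {G} λ a≤l l<b b<k →
    G-shiInequalities (alcove⇒shiInequalities {y = y} yc c≥0) a≤l l<b (ℕP.m<n⇒m<1+n b<k)
  w = proj₁ realised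
  wG = proj₂ (proj₂ realised)
  cmp′ = restrict-complement {x = x} cmp
  dom′ = restrict-dominant {x = x} dom
  x′~w = restrict-sameRegion {x = x} {y} {w} {c} {coordsOf G} x~y yc wG agree
  tableau : ∀ i j → i Fin.≤ j → T (inject₁ i) (inject₁ j) ≡ coordsOf G i j ℤ.⊓ + m
  tableau i j i≤j = trans (T≡c⊓m _ _ (inject₁-mono i≤j)) (agree i j i≤j)
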